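{- Let $f(x,y)=\frac{f_{1}(x,y)}{f_{2}(x,y)}$, where $f_{1},f_{2}\in\mathbb{Z}[x,y]$ are (nonzero) homogeneous forms of degrees $d_{1},d_{2}$ respectively, with $|d_{1}-d_{2}|=1$. Then for every $a\in\mathbb{Q}\setminus\{0\}$ and every $Q\in\mathbb{Q}\setminus\{ -1,0,1\}$ we have $\mathcal{G}(a,Q)\subset\mathcal{V}_{f}$ if and only if $a=f(u,v)$ for some $u,v\in\mathbb{Q}$ (with $f(u,v)$ defined).
   Context: For $a,Q\in\mathbb{Q}$ with $aQ(Q^2-1)\neq 0$, $\mathcal{G}(a,Q)=\{aQ^{i}:\ i\in\mathbb{N}\}$, where $\mathbb{N}=\{0,1,2,\dots\}$. For $f\in\mathbb{Q}(x,y)$, $\mathcal{V}_{f}=\{f(u,v):\ u,v\in\mathbb{Q}\text{ such that }f(u,v)\text{ is defined}\}$. -}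

module Defs where

open import Data.Nat using (ℕ; zero; suc)
open import Data.Integer using (ℤ)
open import Data.Rational using (ℚ; 0ℚ; 1ℚ; _+_; _*_; _÷_; ≢-nonZero)
import Data.Rational as ℚ
open import Data.Fin using (Fin)
open import Data.Vec using (Vec; []; _∷_; lookup)
open import Data.Product using (Σ; ∃; _×_; _,_)
open import Relation.Binary.PropositionalEquality using (_≡_; _≢_)

_^_ : ℚ → ℕ → ℚ
q ^ zero  = 1ℚ
q ^ suc n = q * (q ^ n)

-- A binary homogeneous form of degree d with integer coefficients:
--   F(x,y) = Σ_{i=0}^{d} c_i x^i y^(d-i),  given by (c_0, …, c_d).
Form : ℕ → Set
Form d = Vec ℤ (suc d)

evalAux : (k : ℕ) → Vec ℤ (suc k) → ℚ → ℚ → ℚ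
evalAux zero    (c ∷ [])     x y = ℚ._/_ c 1
evalAux (suc k) (c ∷ cs)     x y = (ℚ._/_ c 1) * (y ^ suc k) + x * evalAux k cs x y

evalForm : ∀ {d} → Form d → ℚ → ℚ → ℚ
evalForm {d} F x y = evalAux d F x y

NonzeroForm : ∀ {d} → Form d → Set
NonzeroForm {d} F = Σ (Fin (suc d)) λ i → lookup F i ≢ Data.Integer.0ℤ
  where import Data.Integer

fValue : ∀ {d₁ d₂} (F₁ : Form d₁) (F₂ : Form d₂) (u v : ℚ) →
         evalForm F₂ u v ≢ 0ℚ → ℚ
fValue F₁ F₂ u v ne = _÷_ (evalForm F₁ u v) (evalForm F₂ u v) {{≢-nonZero ne}}

InValueSet : ∀ {d₁ d₂} (F₁ : Form d₁) (F₂ : Form d₂) → ℚ → Set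
InValueSet F₁ F₂ q =
  Σ ℚ λ u → Σ ℚ λ v → Σ (evalForm F₂ u v ≢ 0ℚ) λ ne → fValue F₁ F₂ u v ne ≡ q

GeomSubsetValues : ∀ {d₁ d₂} (F₁ : Form d₁) (F₂ : Form d₂) → ℚ → ℚ → Set
GeomSubsetValues F₁ F₂ a Q = (i : ℕ) → InValueSet F₁ F₂ (a * (Q ^ i))

{-# OPTIONS --safe #-}
-- Forms are homogeneous, so f(tu, tv) = t^(d₁ - d₂) f(u, v) for t ≠ 0.  When |d₁ - d₂| = 1
-- this makes the value set of f closed under multiplication by any nonzero rational
-- (scale by t = s when d₁ = d₂ + 1 and by t = 1/s when d₂ = d₁ + 1), so a ∈ V_f already
-- gives a Qⁱ ∈ V_f for every i.  Conversely a = a Q⁰.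
module Submission where

open import Defs
open import Data.Nat using (ℕ; suc; zero)
open import Data.Rational using (ℚ; 0ℚ; 1ℚ; -_; _*_; _+_; _÷_; 1/_; ≢-nonZero)
import Data.Rational as ℚ
open import Data.Rational.Properties
  using (*-comm; *-assoc; *-identityˡ; *-identityʳ; *-zeroʳ; *-inverseˡ; *-inverseʳ)
open import Data.Rational.Solver using (module +-*-Solver)
open import Data.Sum using (_⊎_; inj₁; inj₂)
open import Data.Product using (_,_)
open import Data.Vec using (_∷_; [])
open import Relation.Binary.PropositionalEquality
  using (_≡_; _≢_; refl; sym; trans; cong; cong₂; subst; module ≡-Reasoning)
open import Function.Bundles using (_⇔_; mk⇔)

open +-*-Solver
open ≡-Reasoning

*-nonZero : ∀ {x y} → x ≢ 0ℚ → y ≢ 0ℚ → x * y ≢ 0ℚ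
*-nonZero {x} {y} x≢0 y≢0 xy≡0 = y≢0 (begin
  y                 ≡⟨ sym (*-identityˡ y) ⟩
  1ℚ * y            ≡⟨ cong (_* y) (sym (*-inverseˡ x)) ⟩
  (1/ x) * x * y    ≡⟨ *-assoc (1/ x) x y ⟩
  (1/ x) * (x * y)  ≡⟨ cong ((1/ x) *_) xy≡0 ⟩
  (1/ x) * 0ℚ       ≡⟨ *-zeroʳ (1/ x) ⟩
  0ℚ                ∎)
  where instance _ = ≢-nonZero x≢0

^-nonZero : ∀ {t} n → t ≢ 0ℚ → t ^ n ≢ 0ℚ
^-nonZero zero    _   ()
^-nonZero (suc n) t≢0 = *-nonZero t≢0 (^-nonZero n t≢0)

^-distrib-* : ∀ s t n → (s * t) ^ n ≡ s ^ n * t ^ n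
^-distrib-* s t zero    = refl
^-distrib-* s t (suc n) = begin
  (s * t) * (s * t) ^ n        ≡⟨ cong ((s * t) *_) (^-distrib-* s t n) ⟩
  (s * t) * (s ^ n * t ^ n)    ≡⟨ solve 4 (λ s t a b → (s :* t) :* (a :* b) := (s :* a) :* (t :* b))
                                    refl s t (s ^ n) (t ^ n) ⟩
  (s * s ^ n) * (t * t ^ n)    ∎

evalAux-homogeneous : ∀ k cs t x y → evalAux k cs (t * x) (t * y) ≡ t ^ k * evalAux k cs x y
evalAux-homogeneous zero    (c ∷ [])  t x y = sym (*-identityˡ _)
evalAux-homogeneous (suc k) (c ∷ cs) t x y = begin
  C * (t * y) ^ suc k + (t * x) * evalAux k cs (t * x) (t * y)
    ≡⟨ cong₂ (λ p q → C * p + (t * x) * q) (^-distrib-* t y (suc k)) (evalAux-homogeneous k cs t x y) ⟩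
  C * ((t * t ^ k) * (y * y ^ k)) + (t * x) * (t ^ k * E)
    ≡⟨ solve 7 (λ C t tk y yk x E → C :* ((t :* tk) :* (y :* yk)) :+ (t :* x) :* (tk :* E)
                                   := (t :* tk) :* (C :* (y :* yk) :+ x :* E))
         refl C t (t ^ k) y (y ^ k) x E ⟩
  (t * t ^ k) * (C * (y * y ^ k) + x * E)
    ∎
  where C = ℚ._/_ c 1
        E = evalAux k cs x y

evalForm-homogeneous : ∀ {d} (F : Form d) t x y → evalForm F (t * x) (t * y) ≡ t ^ d * evalForm F x y
evalForm-homogeneous {d} = evalAux-homogeneous d

÷≡⇒≡* : ∀ X Y (Y≢0 : Y ≢ 0ℚ) q → _÷_ X Y {{≢-nonZero Y≢0}} ≡ q → X ≡ q * Y
÷≡⇒≡* X Y Y≢0 q X/Y≡q = begin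
  X                  ≡⟨ sym (*-identityʳ X) ⟩
  X * 1ℚ             ≡⟨ cong (X *_) (sym (*-inverseˡ Y)) ⟩
  X * ((1/ Y) * Y)   ≡⟨ sym (*-assoc X (1/ Y) Y) ⟩
  (X ÷ Y) * Y        ≡⟨ cong (_* Y) X/Y≡q ⟩
  q * Y              ∎
  where instance _ = ≢-nonZero Y≢0

≡*⇒÷≡ : ∀ X Y (Y≢0 : Y ≢ 0ℚ) q → X ≡ q * Y → _÷_ X Y {{≢-nonZero Y≢0}} ≡ q
≡*⇒÷≡ X Y Y≢0 q X≡qY = begin
  X * (1/ Y)         ≡⟨ cong (_* (1/ Y)) X≡qY ⟩
  (q * Y) * (1/ Y)   ≡⟨ *-assoc q Y (1/ Y) ⟩
  q * (Y * (1/ Y))   ≡⟨ cong (q *_) (*-inverseʳ Y) ⟩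
  q * 1ℚ             ≡⟨ *-identityʳ q ⟩
  q                  ∎
  where instance _ = ≢-nonZero Y≢0

-- The witness of c * q is (t u, t v), where t^d₁ = c t^d₂ makes f(t u, t v) = c f(u, v).
InValueSet-scale : ∀ {d₁ d₂} (F₁ : Form d₁) (F₂ : Form d₂) {q} t c →
  t ≢ 0ℚ → t ^ d₁ ≡ c * t ^ d₂ → InValueSet F₁ F₂ q → InValueSet F₁ F₂ (c * q)
InValueSet-scale {d₁} {d₂} F₁ F₂ {q} t c t≢0 tᵈ¹≡ctᵈ² (u , v , Y≢0 , f[u,v]≡q) =
  t * u , t * v , Y′≢0 , ≡*⇒÷≡ X′ Y′ Y′≢0 (c * q) X′≡cqY′
  where
  X = evalForm F₁ u v
  Y = evalForm F₂ u v
  X′ = evalForm F₁ (t * u) (t * v)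
  Y′ = evalForm F₂ (t * u) (t * v)

  Y′≡tᵈ²Y : Y′ ≡ t ^ d₂ * Y
  Y′≡tᵈ²Y = evalForm-homogeneous F₂ t u v

  Y′≢0 : Y′ ≢ 0ℚ
  Y′≢0 Y′≡0 = *-nonZero (^-nonZero d₂ t≢0) Y≢0 (trans (sym Y′≡tᵈ²Y) Y′≡0)

  X′≡cqY′ : X′ ≡ (c * q) * Y′
  X′≡cqY′ = begin
    X′                   ≡⟨ evalForm-homogeneous F₁ t u v ⟩
    t ^ d₁ * X           ≡⟨ cong₂ _*_ tᵈ¹≡ctᵈ² (÷≡⇒≡* X Y Y≢0 q f[u,v]≡q) ⟩
    (c * t ^ d₂) * (q * Y) ≡⟨ solve 4 (λ c tk q Y → (c :* tk) :* (q :* Y) := (c :* q) :* (tk :* Y))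
                                refl c (t ^ d₂) q Y ⟩
    (c * q) * (t ^ d₂ * Y) ≡⟨ cong ((c * q) *_) (sym Y′≡tᵈ²Y) ⟩
    (c * q) * Y′         ∎

InValueSet-*-closed : ∀ {d₁ d₂} (F₁ : Form d₁) (F₂ : Form d₂) →
  (d₁ ≡ suc d₂ ⊎ d₂ ≡ suc d₁) →
  ∀ {q} s → s ≢ 0ℚ → InValueSet F₁ F₂ q → InValueSet F₁ F₂ (s * q)
InValueSet-*-closed F₁ F₂ (inj₁ refl) s s≢0 = InValueSet-scale F₁ F₂ s s s≢0 refl
InValueSet-*-closed {d₁} F₁ F₂ (inj₂ refl) s s≢0 =
  InValueSet-scale F₁ F₂ t s t≢0 tᵈ¹≡s·tᵈ¹⁺¹
  where
  instance _ = ≢-nonZero s≢0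
  t = 1/ s

  t≢0 : t ≢ 0ℚ
  t≢0 t≡0 with () ← trans (sym (*-inverseʳ s)) (trans (cong (s *_) t≡0) (*-zeroʳ s))

  tᵈ¹≡s·tᵈ¹⁺¹ : t ^ d₁ ≡ s * t ^ suc d₁
  tᵈ¹≡s·tᵈ¹⁺¹ = begin
    t ^ d₁             ≡⟨ sym (*-identityˡ (t ^ d₁)) ⟩
    1ℚ * t ^ d₁        ≡⟨ cong (_* t ^ d₁) (sym (*-inverseʳ s)) ⟩
    (s * t) * t ^ d₁   ≡⟨ *-assoc s t (t ^ d₁) ⟩
    s * t ^ suc d₁     ∎

theorem2p3 : (d₁ d₂ : ℕ) (F₁ : Form d₁) (F₂ : Form d₂) →
    NonzeroForm F₁ → NonzeroForm F₂ →
    (d₁ ≡ suc d₂ ⊎ d₂ ≡ suc d₁) →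
    (a Q : ℚ) → a ≢ 0ℚ → Q ≢ 0ℚ → Q ≢ 1ℚ → Q ≢ - 1ℚ →
    (GeomSubsetValues F₁ F₂ a Q ⇔ InValueSet F₁ F₂ a)
theorem2p3 d₁ d₂ F₁ F₂ _ _ deg a Q _ Q≢0 _ _ = mk⇔ first-term all-terms
  where
  first-term : GeomSubsetValues F₁ F₂ a Q → InValueSet F₁ F₂ a
  first-term a·Qⁱ∈V = subst (InValueSet F₁ F₂) (*-identityʳ a) (a·Qⁱ∈V 0)

  all-terms : InValueSet F₁ F₂ a → GeomSubsetValues F₁ F₂ a Q
  all-terms a∈V i = subst (InValueSet F₁ F₂) (*-comm (Q ^ i) a)
    (InValueSet-*-closed F₁ F₂ deg (Q ^ i) (^-nonZero i Q≢0) a∈V)
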